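{- Let $G$ be a 3-regular graph and let $H$ be a triangle-free 3-regular graph. Then there exists a locally bijective homomorphism from $G$ to $H$ if and only if there exists a locally bijective homomorphism from $L(G)$ to $L(H)$.
   Context: Graphs are finite and simple; $L(\cdot)$ denotes the line graph. A locally bijective homomorphism from $G$ to $H$ is a map $\psi\colon V(G)\to V(H)$ such that for every $v\in V(G)$ the restriction of $\psi$ to $N_G(v)$ is a bijection onto $N_H(\psi(v))$. -}

module Defs where

open import Data.Nat using (ℕ)
open import Data.Fin using (Fin; _<_; _≟_)
open import Data.Bool using (Bool; true; false; T; _∧_; _∨_; not)
open import Data.List using (length; filterᵇ; allFin)
open import Data.Product using (Σ; _×_; _,_; proj₁; proj₂; ∃-syntax)
open import Relation.Nullary using (¬_)
import Relation.Nullary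
import Data.Empty
open import Relation.Nullary.Decidable using (⌊_⌋)
open import Relation.Binary.PropositionalEquality using (_≡_)
open import Function.Definitions using (Bijective)
open import Relation.Binary.PropositionalEquality using (refl; cong₂)

-- A simple graph on an arbitrary vertex type, with Boolean adjacency
-- (so adjacency proofs T (adj u v) are proof-irrelevant), symmetric, loopless.
record Graph : Set₁ where
  field
    V      : Set
    adj    : V → V → Bool
    sym    : ∀ u v → adj u v ≡ adj v u
    irrefl : ∀ v → adj v v ≡ false
open Graph public

record FinGraph (n : ℕ) : Set where
  field
    adjF    : Fin n → Fin n → Bool
    symF    : ∀ u v → adjF u v ≡ adjF v u
    irreflF : ∀ v → adjF v v ≡ false
open FinGraph public

toGraph : ∀ {n} → FinGraph n → Graph
toGraph {n} G = record { V = Fin n ; adj = adjF G ; sym = symF G ; irrefl = irreflF G }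

N : (G : Graph) → V G → Set
N G v = Σ (V G) (λ u → T (adj G v u))

record LocBijHom (G H : Graph) : Set where
  field
    ψ     : V G → V H
    hom   : ∀ u v → T (adj G u v) → T (adj H (ψ u) (ψ v))
  restrict : (v : V G) → N G v → N H (ψ v)
  restrict v (u , e) = ψ u , hom v u e
  field
    bij   : ∀ v → Bijective _≡_ _≡_ (restrict v)

degree : ∀ {n} → FinGraph n → Fin n → ℕ
degree {n} G v = length (filterᵇ (adjF G v) (allFin n))

Cubic : ∀ {n} → FinGraph n → Set
Cubic G = ∀ v → degree G v ≡ 3

TriangleFree : ∀ {n} → FinGraph n → Set
TriangleFree G = ¬ (∃[ u ] ∃[ v ] ∃[ w ]
  (T (adjF G u v) × T (adjF G v w) × T (adjF G u w)))

-- Line graph: vertices are edges {i,j} written canonically with i < j;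
-- two distinct edges are adjacent iff they share an endpoint.
EdgeOf : ∀ {n} → FinGraph n → Set
EdgeOf {n} G = Σ (Fin n × Fin n) (λ p → (proj₁ p < proj₂ p) × T (adjF G (proj₁ p) (proj₂ p)))

_==_ : ∀ {n} → Fin n → Fin n → Bool
i == j = ⌊ i ≟ j ⌋

lineAdj : ∀ {n} (G : FinGraph n) → EdgeOf G → EdgeOf G → Bool
lineAdj G ((i , j) , _) ((k , l) , _) =
  not ((i == k) ∧ (j == l)) ∧ ((i == k) ∨ (i == l) ∨ (j == k) ∨ (j == l))

==-sym : ∀ {n} (i j : Fin n) → (i == j) ≡ (j == i)
==-sym i j with i ≟ j | j ≟ i
... | Relation.Nullary.yes _ | Relation.Nullary.yes _ = refl
... | Relation.Nullary.no _ | Relation.Nullary.no _ = refl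
... | Relation.Nullary.yes refl | Relation.Nullary.no q = Data.Empty.⊥-elim (q refl)
... | Relation.Nullary.no q | Relation.Nullary.yes refl = Data.Empty.⊥-elim (q refl)

==-refl : ∀ {n} (i : Fin n) → (i == i) ≡ true
==-refl i with i ≟ i
... | Relation.Nullary.yes _ = refl
... | Relation.Nullary.no q = Data.Empty.⊥-elim (q refl)

lineAdj-sym : ∀ {n} (G : FinGraph n) e f → lineAdj G e f ≡ lineAdj G f e
lineAdj-sym G ((i , j) , _) ((k , l) , _)
  rewrite ==-sym i k | ==-sym j l | ==-sym i l | ==-sym j k
  with (k == i) | (l == j) | (l == i) | (k == j)
... | a | b | c | d = cong₂ _∧_ refl (lem a c d b)
  where
  lem : ∀ a c d b → (a ∨ c ∨ d ∨ b) ≡ (a ∨ d ∨ c ∨ b)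
  lem true c d b = refl
  lem false true true b = refl
  lem false true false b = refl
  lem false false true b = refl
  lem false false false b = refl

lineAdj-irrefl : ∀ {n} (G : FinGraph n) e → lineAdj G e e ≡ false
lineAdj-irrefl G ((i , j) , _) rewrite ==-refl i | ==-refl j = refl

L : ∀ {n} → FinGraph n → Graph
L G = record { V = EdgeOf G ; adj = lineAdj G ; sym = lineAdj-sym G ; irrefl = lineAdj-irrefl G }

{-# OPTIONS --safe #-}
-- A locally bijective φ : G → H lifts to L(G) → L(H) by sending the edge xy to φx φy; this
-- direction needs no degree assumption. Conversely, given Ψ : L(G) → L(H), the three edges at a
-- vertex v of G are pairwise adjacent in L(G), so their images form a triangle of L(H). As H is
-- triangle-free, every triangle of L(H) is a star, and its centre is taken as φ v. Since H is
-- cubic, no vertex of H carries four edges, which forces φ to separate adjacent vertices, to be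
-- a homomorphism, and to be bijective on neighbourhoods.
module Submission where

open import Defs hiding (sym)
open import Data.Nat using (_≤_)
open import Data.Nat.Properties using (<-irrefl)
open import Data.Fin using (Fin; zero; suc; _≟_)
open import Data.Fin.Properties using (<-cmp; <-irrelevant; <-asym; <⇒≢; injective⇒≤)
open import Data.Bool using (T)
open import Data.Bool.Properties using (T-irrelevant)
open import Data.List using (List; []; _∷_; length; filterᵇ; allFin)
open import Data.List.Membership.Propositional using (_∈_)
open import Data.List.Membership.Propositional.Properties using (∈-filter⁺; ∈-filter⁻; ∈-allFin)
open import Data.List.Relation.Unary.Any using (here; there)
open import Data.List.Relation.Unary.AllPairs using ([]; _∷_)
open import Data.List.Relation.Unary.All using ([]; _∷_)
import Data.List.Relation.Unary.Unique.Propositional as List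
import Data.List.Relation.Unary.Unique.Propositional.Properties as List
open import Data.Vec using (Vec; []; _∷_; lookup)
open import Data.Vec.Relation.Unary.All using (All; []; _∷_)
open import Data.Vec.Relation.Unary.AllPairs using ([]; _∷_)
open import Data.Vec.Relation.Unary.All.Properties using (lookup⁺)
open import Data.Vec.Relation.Unary.Unique.Propositional using (Unique)
open import Data.Vec.Relation.Unary.Unique.Propositional.Properties using (lookup-injective)
open import Data.Product using (∃-syntax; _×_; _,_; proj₁; proj₂)
open import Data.Sum using (_⊎_; inj₁; inj₂)
open import Data.Empty using (⊥; ⊥-elim)
open import Relation.Nullary using (¬_; Dec; yes; no; ¬?; _×-dec_; _⊎-dec_)
open import Relation.Nullary.Decidable using (T?; isYes; toWitness; fromWitness; isYes≗does)
open import Relation.Binary.Definitions using (tri<; tri≈; tri>)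
open import Relation.Binary.PropositionalEquality
open import Function using (_∘_)

record ExactlyThree {A : Set} (P : A → Set) : Set where
  field
    a b c      : A
    a≢b        : a ≢ b
    a≢c        : a ≢ c
    b≢c        : b ≢ c
    Pa         : P a
    Pb         : P b
    Pc         : P c
    exhaustive : ∀ x → P x → x ≡ a ⊎ x ≡ b ⊎ x ≡ c

fromUniqueList : ∀ {A : Set} {P : A → Set} (xs : List A) → List.Unique xs → length xs ≡ 3 →
  (∀ x → x ∈ xs → P x) → (∀ x → P x → x ∈ xs) → ExactlyThree P
fromUniqueList (a ∷ b ∷ c ∷ []) ((a≢b ∷ a≢c ∷ []) ∷ (b≢c ∷ []) ∷ [] ∷ []) refl sound complete = record
  { a = a ; b = b ; c = c ; a≢b = a≢b ; a≢c = a≢c ; b≢c = b≢c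
  ; Pa = sound a (here refl) ; Pb = sound b (there (here refl)) ; Pc = sound c (there (there (here refl)))
  ; exhaustive = λ x Px → cases (complete x Px) }
  where
  cases : ∀ {x} → x ∈ a ∷ b ∷ c ∷ [] → x ≡ a ⊎ x ≡ b ⊎ x ≡ c
  cases (here x≡a)                 = inj₁ x≡a
  cases (there (here x≡b))         = inj₂ (inj₁ x≡b)
  cases (there (there (here x≡c))) = inj₂ (inj₂ x≡c)

cubic⇒neighbours : ∀ {n} (G : FinGraph n) → Cubic G → ∀ v → ExactlyThree (λ x → T (adjF G v x))
cubic⇒neighbours {n} G cubic v = fromUniqueList (filterᵇ (adjF G v) (allFin n))
  (List.filter⁺ (λ x → T? (adjF G v x)) (List.allFin⁺ n)) (cubic v)
  (λ x x∈ → proj₂ (∈-filter⁻ (λ x → T? (adjF G v x)) {xs = allFin n} x∈))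
  (λ x vx → ∈-filter⁺ (λ x → T? (adjF G v x)) (∈-allFin x) vx)

module _ {A : Set} {P : A → Set} (three : ExactlyThree P) where
  open ExactlyThree three

  private
    position : ∀ {x} → x ≡ a ⊎ x ≡ b ⊎ x ≡ c → Fin 3
    position (inj₁ _)        = zero
    position (inj₂ (inj₁ _)) = suc zero
    position (inj₂ (inj₂ _)) = suc (suc zero)

    position-injective : ∀ {x y} (p : x ≡ a ⊎ x ≡ b ⊎ x ≡ c) (q : y ≡ a ⊎ y ≡ b ⊎ y ≡ c) →
      position p ≡ position q → x ≡ y
    position-injective (inj₁ refl)        (inj₁ refl)        _ = refl
    position-injective (inj₂ (inj₁ refl)) (inj₂ (inj₁ refl)) _ = refl
    position-injective (inj₂ (inj₂ refl)) (inj₂ (inj₂ refl)) _ = refl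
    position-injective (inj₁ _)           (inj₂ (inj₁ _))    ()
    position-injective (inj₁ _)           (inj₂ (inj₂ _))    ()
    position-injective (inj₂ (inj₁ _))    (inj₁ _)           ()
    position-injective (inj₂ (inj₁ _))    (inj₂ (inj₂ _))    ()
    position-injective (inj₂ (inj₂ _))    (inj₁ _)           ()
    position-injective (inj₂ (inj₂ _))    (inj₂ (inj₁ _))    ()

  unique⇒length≤3 : ∀ {k} {xs : Vec A k} → Unique xs → All P xs → k ≤ 3
  unique⇒length≤3 {xs = xs} unique Pxs = injective⇒≤ {f = λ i → position (place i)}
    λ {i} {j} eq → lookup-injective unique i j (position-injective (place i) (place j) eq)
    where
    place : ∀ i → lookup xs i ≡ a ⊎ lookup xs i ≡ b ⊎ lookup xs i ≡ c
    place i = exhaustive (lookup xs i) (lookup⁺ Pxs i)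

  no-four-distinct : ∀ {w x y z} → P w → P x → P y → P z →
    w ≢ x → w ≢ y → w ≢ z → x ≢ y → x ≢ z → y ≢ z → ⊥
  no-four-distinct Pw Px Py Pz w≢x w≢y w≢z x≢y x≢z y≢z = <-irrefl refl
    (unique⇒length≤3 ((w≢x ∷ w≢y ∷ w≢z ∷ []) ∷ (x≢y ∷ x≢z ∷ []) ∷ (y≢z ∷ []) ∷ [] ∷ [])
                     (Pw ∷ Px ∷ Py ∷ Pz ∷ []))

  two-others : ∀ {u} → P u → ∃[ x ] ∃[ y ] P x × P y × x ≢ y × x ≢ u × y ≢ u
  two-others {u} Pu with exhaustive u Pu
  ... | inj₁ refl        = b , c , Pb , Pc , b≢c , a≢b ∘ sym , a≢c ∘ sym
  ... | inj₂ (inj₁ refl) = a , c , Pa , Pc , a≢c , a≢b , b≢c ∘ sym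
  ... | inj₂ (inj₂ refl) = a , b , Pa , Pb , a≢b , a≢c , b≢c

adj⇒≢ : ∀ (G : Graph) {x y} → T (adj G x y) → x ≢ y
adj⇒≢ G {x} xy refl = subst T (irrefl G x) xy

neighbour-≡ : ∀ (G : Graph) {v x y} {vx : T (adj G v x)} {vy : T (adj G v y)} → x ≡ y →
  _≡_ {A = N G v} (x , vx) (y , vy)
neighbour-≡ G {x = x} {vx = vx} {vy} refl = cong (x ,_) (T-irrelevant vx vy)

module _ {A B : Graph} (F : LocBijHom A B) where
  open LocBijHom F

  restrict-injective : ∀ {v x y} → T (adj A v x) → T (adj A v y) → ψ x ≡ ψ y → x ≡ y
  restrict-injective {v} {x} {y} vx vy eq = cong proj₁ (proj₁ (bij v) {x , vx} {y , vy} (neighbour-≡ B eq))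

  restrict-surjective : ∀ {v w} → T (adj B (ψ v) w) → ∃[ x ] T (adj A v x) × ψ x ≡ w
  restrict-surjective {v} {w} ψvw with proj₂ (bij v) (w , ψvw)
  ... | (x , vx) , onto = x , vx , cong proj₁ (onto refl)

mkLocBijHom : ∀ {A B : Graph} (f : V A → V B) →
  (∀ u v → T (adj A u v) → T (adj B (f u) (f v))) →
  (∀ v {x y} → T (adj A v x) → T (adj A v y) → f x ≡ f y → x ≡ y) →
  (∀ v {w} → T (adj B (f v) w) → ∃[ x ] T (adj A v x) × f x ≡ w) →
  LocBijHom A B
mkLocBijHom {A} {B} f hom injective surjective = record
  { ψ   = f
  ; hom = hom
  ; bij = λ v →
      (λ {x} {y} eq → neighbour-≡ A (injective v (proj₂ x) (proj₂ y) (cong proj₁ eq))) ,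
      λ { (w , fvw) → let (x , vx , fx≡w) = surjective v fvw
                      in (x , vx) , λ { refl → neighbour-≡ B fx≡w } } }

module Edges {n} (G : FinGraph n) where

  adj-sym : ∀ {x y} → T (adjF G x y) → T (adjF G y x)
  adj-sym {x} {y} = subst T (symF G x y)

  infix 4 _∈ᵉ_
  _∈ᵉ_ : Fin n → EdgeOf G → Set
  x ∈ᵉ ((i , j) , _) = x ≡ i ⊎ x ≡ j

  edge-≡ : ∀ {i j k l i<j k<l ij kl} → i ≡ k → j ≡ l →
    _≡_ {A = EdgeOf G} ((i , j) , i<j , ij) ((k , l) , k<l , kl)
  edge-≡ refl refl = cong₂ (λ i<j ij → (_ , i<j , ij)) (<-irrelevant _ _) (T-irrelevant _ _)

  edge-determined : ∀ {x y} (e f : EdgeOf G) → x ≢ y → x ∈ᵉ e → y ∈ᵉ e → x ∈ᵉ f → y ∈ᵉ f → e ≡ f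
  edge-determined _ _ x≢y (inj₁ refl) (inj₁ refl) _ _ = ⊥-elim (x≢y refl)
  edge-determined _ _ x≢y (inj₂ refl) (inj₂ refl) _ _ = ⊥-elim (x≢y refl)
  edge-determined _ _ x≢y _ _ (inj₁ refl) (inj₁ refl) = ⊥-elim (x≢y refl)
  edge-determined _ _ x≢y _ _ (inj₂ refl) (inj₂ refl) = ⊥-elim (x≢y refl)
  edge-determined _ _ _ (inj₁ refl) (inj₂ refl) (inj₁ refl) (inj₂ refl) = edge-≡ refl refl
  edge-determined _ _ _ (inj₂ refl) (inj₁ refl) (inj₂ refl) (inj₁ refl) = edge-≡ refl refl
  edge-determined (_ , i<j , _) (_ , k<l , _) _ (inj₁ refl) (inj₂ refl) (inj₂ refl) (inj₁ refl) =
    ⊥-elim (<-asym i<j k<l)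
  edge-determined (_ , i<j , _) (_ , k<l , _) _ (inj₂ refl) (inj₁ refl) (inj₁ refl) (inj₂ refl) =
    ⊥-elim (<-asym i<j k<l)

  other-endpoint : ∀ {x} (e : EdgeOf G) → x ∈ᵉ e → ∃[ y ] y ∈ᵉ e × x ≢ y
  other-endpoint ((i , j) , i<j , _) (inj₁ refl) = j , inj₂ refl , <⇒≢ i<j
  other-endpoint ((i , j) , i<j , _) (inj₂ refl) = i , inj₁ refl , <⇒≢ i<j ∘ sym

  endpoint-cases : ∀ {x y z} (e : EdgeOf G) → x ∈ᵉ e → y ∈ᵉ e → x ≢ y → z ∈ᵉ e → z ≡ x ⊎ z ≡ y
  endpoint-cases _ (inj₁ refl) (inj₁ refl) x≢y _ = ⊥-elim (x≢y refl)
  endpoint-cases _ (inj₂ refl) (inj₂ refl) x≢y _ = ⊥-elim (x≢y refl)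
  endpoint-cases _ (inj₁ refl) (inj₂ refl) _ z∈e = z∈e
  endpoint-cases _ (inj₂ refl) (inj₁ refl) _ (inj₁ z≡i) = inj₂ z≡i
  endpoint-cases _ (inj₂ refl) (inj₁ refl) _ (inj₂ z≡j) = inj₁ z≡j

  endpoints-adjacent : ∀ {x y} (e : EdgeOf G) → x ∈ᵉ e → y ∈ᵉ e → x ≢ y → T (adjF G x y)
  endpoints-adjacent _ (inj₁ refl) (inj₁ refl) x≢y = ⊥-elim (x≢y refl)
  endpoints-adjacent _ (inj₂ refl) (inj₂ refl) x≢y = ⊥-elim (x≢y refl)
  endpoints-adjacent (_ , _ , ij) (inj₁ refl) (inj₂ refl) _ = ij
  endpoints-adjacent ((i , j) , _ , ij) (inj₂ refl) (inj₁ refl) _ = adj-sym ij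

  edge : (x y : Fin n) → T (adjF G x y) → EdgeOf G
  edge x y xy with <-cmp x y
  ... | tri< x<y _ _ = (x , y) , x<y , xy
  ... | tri≈ _ x≡y _ = ⊥-elim (adj⇒≢ (toGraph G) xy x≡y)
  ... | tri> _ _ y<x = (y , x) , y<x , adj-sym xy

  edge-∈ˡ : ∀ x y xy → x ∈ᵉ edge x y xy
  edge-∈ˡ x y xy with <-cmp x y
  ... | tri< _ _ _   = inj₁ refl
  ... | tri≈ _ x≡y _ = ⊥-elim (adj⇒≢ (toGraph G) xy x≡y)
  ... | tri> _ _ _   = inj₂ refl

  edge-∈ʳ : ∀ x y xy → y ∈ᵉ edge x y xy
  edge-∈ʳ x y xy with <-cmp x y
  ... | tri< _ _ _   = inj₂ refl
  ... | tri≈ _ x≡y _ = ⊥-elim (adj⇒≢ (toGraph G) xy x≡y)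
  ... | tri> _ _ _   = inj₁ refl

  edge-∈⁻ : ∀ {z} x y xy → z ∈ᵉ edge x y xy → z ≡ x ⊎ z ≡ y
  edge-∈⁻ x y xy z∈e with <-cmp x y
  edge-∈⁻ x y xy z∈e        | tri< _ _ _   = z∈e
  edge-∈⁻ x y xy _          | tri≈ _ x≡y _ = ⊥-elim (adj⇒≢ (toGraph G) xy x≡y)
  edge-∈⁻ x y xy (inj₁ z≡y) | tri> _ _ _   = inj₂ z≡y
  edge-∈⁻ x y xy (inj₂ z≡x) | tri> _ _ _   = inj₁ z≡x

  edge-unique : ∀ {x y} (xy : T (adjF G x y)) e → x ∈ᵉ e → y ∈ᵉ e → edge x y xy ≡ e
  edge-unique {x} {y} xy e =
    edge-determined (edge x y xy) e (adj⇒≢ (toGraph G) xy) (edge-∈ˡ x y xy) (edge-∈ʳ x y xy)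

  edge-≢ : ∀ {x y z} (xy : T (adjF G x y)) (f : EdgeOf G) → z ∈ᵉ f → z ≢ x → z ≢ y → edge x y xy ≢ f
  edge-≢ {x} {y} xy f z∈f z≢x z≢y refl with edge-∈⁻ x y xy z∈f
  ... | inj₁ z≡x = z≢x z≡x
  ... | inj₂ z≡y = z≢y z≡y

  private
    Meets : EdgeOf G → EdgeOf G → Set
    Meets ((i , j) , _) ((k , l) , _) = ¬ (i ≡ k × j ≡ l) × (i ≡ k ⊎ i ≡ l ⊎ j ≡ k ⊎ j ≡ l)

    meets? : ∀ e f → Dec (Meets e f)
    meets? ((i , j) , _) ((k , l) , _) =
      ¬? (i ≟ k ×-dec j ≟ l) ×-dec (i ≟ k ⊎-dec i ≟ l ⊎-dec j ≟ k ⊎-dec j ≟ l)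

    -- lineAdj is built from isYes, whereas the Dec combinators compute with does.
    lineAdj≡meets? : ∀ e f → lineAdj G e f ≡ isYes (meets? e f)
    lineAdj≡meets? e@((i , j) , _) f@((k , l) , _)
      rewrite isYes≗does (meets? e f)
            | isYes≗does (i ≟ k) | isYes≗does (j ≟ l) | isYes≗does (i ≟ l) | isYes≗does (j ≟ k) = refl

  lineAdj⇒ : ∀ e f → T (lineAdj G e f) → e ≢ f × ∃[ x ] x ∈ᵉ e × x ∈ᵉ f
  lineAdj⇒ e@((i , j) , _) f@((k , l) , _) ef
    with toWitness {a? = meets? e f} (subst T (lineAdj≡meets? e f) ef)
  ... | notSame , shared = (λ { refl → notSame (refl , refl) }) , common shared
    where
    common : i ≡ k ⊎ i ≡ l ⊎ j ≡ k ⊎ j ≡ l → ∃[ x ] (x ≡ i ⊎ x ≡ j) × (x ≡ k ⊎ x ≡ l)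
    common (inj₁ i≡k)               = i , inj₁ refl , inj₁ i≡k
    common (inj₂ (inj₁ i≡l))        = i , inj₁ refl , inj₂ i≡l
    common (inj₂ (inj₂ (inj₁ j≡k))) = j , inj₂ refl , inj₁ j≡k
    common (inj₂ (inj₂ (inj₂ j≡l))) = j , inj₂ refl , inj₂ j≡l

  lineAdj⇐ : ∀ {x} e f → e ≢ f → x ∈ᵉ e → x ∈ᵉ f → T (lineAdj G e f)
  lineAdj⇐ e@((i , j) , _) f@((k , l) , _) e≢f x∈e x∈f = subst T (sym (lineAdj≡meets? e f))
    (fromWitness {a? = meets? e f} ((λ (i≡k , j≡l) → e≢f (edge-≡ i≡k j≡l)) , shared x∈e x∈f))
    where
    shared : ∀ {x} → x ≡ i ⊎ x ≡ j → x ≡ k ⊎ x ≡ l → i ≡ k ⊎ i ≡ l ⊎ j ≡ k ⊎ j ≡ l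
    shared (inj₁ refl) (inj₁ refl) = inj₁ refl
    shared (inj₁ refl) (inj₂ refl) = inj₂ (inj₁ refl)
    shared (inj₂ refl) (inj₁ refl) = inj₂ (inj₂ (inj₁ refl))
    shared (inj₂ refl) (inj₂ refl) = inj₂ (inj₂ (inj₂ refl))

  lineAdj⇒≢ : ∀ e f → T (lineAdj G e f) → e ≢ f
  lineAdj⇒≢ e f ef = proj₁ (lineAdj⇒ e f ef)

  edges-at-adjacent : ∀ {v x y} (vx : T (adjF G v x)) (vy : T (adjF G v y)) → x ≢ y →
    T (lineAdj G (edge v x vx) (edge v y vy))
  edges-at-adjacent {v} {x} {y} vx vy x≢y = lineAdj⇐ (edge v x vx) (edge v y vy)
    (edge-≢ vx (edge v y vy) (edge-∈ʳ v y vy) (adj⇒≢ (toGraph G) vy ∘ sym) (x≢y ∘ sym))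
    (edge-∈ˡ v x vx) (edge-∈ˡ v y vy)

module _ {m} (H : FinGraph m) where
  open Edges H

  triangleFree⇒star : TriangleFree H → ∀ {w} E₁ E₂ E₃ →
    T (lineAdj H E₁ E₂) → T (lineAdj H E₁ E₃) → T (lineAdj H E₂ E₃) → w ∈ᵉ E₁ → w ∈ᵉ E₂ → w ∈ᵉ E₃
  triangleFree⇒star triangleFree E₁ E₂ E₃ E₁E₂ E₁E₃ E₂E₃ w∈E₁ w∈E₂
    with other-endpoint E₁ w∈E₁ | other-endpoint E₂ w∈E₂ | lineAdj⇒ E₁ E₃ E₁E₃ | lineAdj⇒ E₂ E₃ E₂E₃
  ... | x₁ , x₁∈E₁ , w≢x₁ | x₂ , x₂∈E₂ , w≢x₂ | _ , s₁ , s₁∈E₁ , s₁∈E₃ | _ , s₂ , s₂∈E₂ , s₂∈E₃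
    with endpoint-cases E₁ w∈E₁ x₁∈E₁ w≢x₁ s₁∈E₁ | endpoint-cases E₂ w∈E₂ x₂∈E₂ w≢x₂ s₂∈E₂
  ... | inj₁ refl | _         = s₁∈E₃
  ... | inj₂ _    | inj₁ refl = s₂∈E₃
  ... | inj₂ refl | inj₂ refl = ⊥-elim (triangleFree (_ , x₁ , x₂ ,
          endpoints-adjacent E₁ w∈E₁ x₁∈E₁ w≢x₁ , endpoints-adjacent E₃ s₁∈E₃ s₂∈E₃ x₁≢x₂ ,
          endpoints-adjacent E₂ w∈E₂ x₂∈E₂ w≢x₂))
    where
    x₁≢x₂ : x₁ ≢ x₂
    x₁≢x₂ refl = lineAdj⇒≢ E₁ E₂ E₁E₂ (edge-determined E₁ E₂ w≢x₁ w∈E₁ x₁∈E₁ w∈E₂ x₂∈E₂)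

  cubic⇒no-four-edges-at : Cubic H → ∀ {w} E₀ E₁ E₂ E₃ → w ∈ᵉ E₀ → w ∈ᵉ E₁ → w ∈ᵉ E₂ → w ∈ᵉ E₃ →
    E₀ ≢ E₁ → E₀ ≢ E₂ → E₀ ≢ E₃ → E₁ ≢ E₂ → E₁ ≢ E₃ → E₂ ≢ E₃ → ⊥
  cubic⇒no-four-edges-at cubic {w} E₀ E₁ E₂ E₃ w∈E₀ w∈E₁ w∈E₂ w∈E₃ E₀≢E₁ E₀≢E₂ E₀≢E₃ E₁≢E₂ E₁≢E₃ E₂≢E₃
    with other-endpoint E₀ w∈E₀ | other-endpoint E₁ w∈E₁ | other-endpoint E₂ w∈E₂ | other-endpoint E₃ w∈E₃
  ... | x₀ , x₀∈E₀ , w≢x₀ | x₁ , x₁∈E₁ , w≢x₁ | x₂ , x₂∈E₂ , w≢x₂ | x₃ , x₃∈E₃ , w≢x₃ =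
    no-four-distinct (cubic⇒neighbours H cubic w)
      (endpoints-adjacent E₀ w∈E₀ x₀∈E₀ w≢x₀) (endpoints-adjacent E₁ w∈E₁ x₁∈E₁ w≢x₁)
      (endpoints-adjacent E₂ w∈E₂ x₂∈E₂ w≢x₂) (endpoints-adjacent E₃ w∈E₃ x₃∈E₃ w≢x₃)
      (far-ends-≢ E₀≢E₁ w≢x₀ w∈E₀ x₀∈E₀ w∈E₁ x₁∈E₁) (far-ends-≢ E₀≢E₂ w≢x₀ w∈E₀ x₀∈E₀ w∈E₂ x₂∈E₂)
      (far-ends-≢ E₀≢E₃ w≢x₀ w∈E₀ x₀∈E₀ w∈E₃ x₃∈E₃) (far-ends-≢ E₁≢E₂ w≢x₁ w∈E₁ x₁∈E₁ w∈E₂ x₂∈E₂)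
      (far-ends-≢ E₁≢E₃ w≢x₁ w∈E₁ x₁∈E₁ w∈E₃ x₃∈E₃) (far-ends-≢ E₂≢E₃ w≢x₂ w∈E₂ x₂∈E₂ w∈E₃ x₃∈E₃)
    where
    far-ends-≢ : ∀ {E E′ x x′} → E ≢ E′ → w ≢ x → w ∈ᵉ E → x ∈ᵉ E → w ∈ᵉ E′ → x′ ∈ᵉ E′ → x ≢ x′
    far-ends-≢ {E} {E′} E≢E′ w≢x w∈E x∈E w∈E′ x′∈E′ refl = E≢E′ (edge-determined E E′ w≢x w∈E x∈E w∈E′ x′∈E′)

module ToLineGraphs {n m} {G : FinGraph n} {H : FinGraph m}
  (F : LocBijHom (toGraph G) (toGraph H)) where
  open LocBijHom F renaming (ψ to φ)
  open Edges G
  module EH = Edges H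
  open EH using () renaming (_∈ᵉ_ to _∈ʰ_)

  Ψ : EdgeOf G → EdgeOf H
  Ψ ((i , j) , _ , ij) = EH.edge (φ i) (φ j) (hom i j ij)

  ∈Ψ : ∀ {x} e → x ∈ᵉ e → φ x ∈ʰ Ψ e
  ∈Ψ ((i , j) , _ , ij) (inj₁ refl) = EH.edge-∈ˡ (φ i) (φ j) (hom i j ij)
  ∈Ψ ((i , j) , _ , ij) (inj₂ refl) = EH.edge-∈ʳ (φ i) (φ j) (hom i j ij)

  ∈Ψ⁻ : ∀ {w} e → w ∈ʰ Ψ e → ∃[ x ] x ∈ᵉ e × w ≡ φ x
  ∈Ψ⁻ ((i , j) , _ , ij) w∈Ψe with EH.edge-∈⁻ (φ i) (φ j) (hom i j ij) w∈Ψe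
  ... | inj₁ w≡φi = i , inj₁ refl , w≡φi
  ... | inj₂ w≡φj = j , inj₂ refl , w≡φj

  φ-adj⇒≢ : ∀ {x y} → T (adjF G x y) → φ x ≢ φ y
  φ-adj⇒≢ {x} {y} xy = adj⇒≢ (toGraph H) (hom x y xy)

  φ-neighbour-∈Ψ⇒∈ : ∀ {x y} g → x ∈ᵉ g → T (adjF G x y) → φ y ∈ʰ Ψ g → y ∈ᵉ g
  φ-neighbour-∈Ψ⇒∈ g x∈g xy φy∈Ψg with ∈Ψ⁻ g φy∈Ψg | other-endpoint g x∈g
  ... | u , u∈g , φy≡φu | z , z∈g , x≢z with endpoint-cases g x∈g z∈g x≢z u∈g
  ... | inj₁ refl = ⊥-elim (φ-adj⇒≢ xy (sym φy≡φu))
  ... | inj₂ refl =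
    subst (_∈ᵉ g) (sym (restrict-injective F xy (endpoints-adjacent g x∈g z∈g x≢z) φy≡φu)) z∈g

  Ψ-injective-at : ∀ {x} f g → x ∈ᵉ f → x ∈ᵉ g → Ψ f ≡ Ψ g → f ≡ g
  Ψ-injective-at f g x∈f x∈g Ψf≡Ψg with other-endpoint f x∈f
  ... | y , y∈f , x≢y = edge-determined f g x≢y x∈f y∈f x∈g
          (φ-neighbour-∈Ψ⇒∈ g x∈g (endpoints-adjacent f x∈f y∈f x≢y) (subst (φ y ∈ʰ_) Ψf≡Ψg (∈Ψ f y∈f)))

  Ψ-hom : ∀ e f → T (lineAdj G e f) → T (lineAdj H (Ψ e) (Ψ f))
  Ψ-hom e f ef with lineAdj⇒ e f ef
  ... | e≢f , x , x∈e , x∈f =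
    EH.lineAdj⇐ (Ψ e) (Ψ f) (e≢f ∘ Ψ-injective-at e f x∈e x∈f) (∈Ψ e x∈e) (∈Ψ f x∈f)

  Ψ-restrict-injective : ∀ e {f g} → T (lineAdj G e f) → T (lineAdj G e g) → Ψ f ≡ Ψ g → f ≡ g
  Ψ-restrict-injective e {f} {g} ef eg Ψf≡Ψg with lineAdj⇒ e f ef | lineAdj⇒ e g eg
  ... | _ , x , x∈e , x∈f | _ , y , y∈e , y∈g = Ψ-injective-at f g x∈f x∈g Ψf≡Ψg
    where
    -- f and g meet e in the same vertex x, as φ x ∈ Ψ f = Ψ g.
    x∈g : x ∈ᵉ g
    x∈g with x ≟ y
    ... | yes refl = y∈g
    ... | no x≢y   = φ-neighbour-∈Ψ⇒∈ g y∈g (endpoints-adjacent e y∈e x∈e (x≢y ∘ sym))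
                       (subst (φ x ∈ʰ_) Ψf≡Ψg (∈Ψ f x∈f))

  Ψ-restrict-surjective : ∀ e {h} → T (lineAdj H (Ψ e) h) → ∃[ f ] T (lineAdj G e f) × Ψ f ≡ h
  Ψ-restrict-surjective e {h} Ψe-h with EH.lineAdj⇒ (Ψ e) h Ψe-h
  ... | Ψe≢h , w , w∈Ψe , w∈h with ∈Ψ⁻ e w∈Ψe | EH.other-endpoint h w∈h
  ... | x , x∈e , refl | z , z∈h , φx≢z with restrict-surjective F (EH.endpoints-adjacent h w∈h z∈h φx≢z)
  ... | y , xy , refl = f , lineAdj⇐ e f (λ e≡f → Ψe≢h (trans (cong Ψ e≡f) Ψf≡h)) x∈e (edge-∈ˡ x y xy) , Ψf≡h
    where
    f : EdgeOf G
    f = edge x y xy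
    Ψf≡h : Ψ f ≡ h
    Ψf≡h = EH.edge-determined (Ψ f) h φx≢z (∈Ψ f (edge-∈ˡ x y xy)) (∈Ψ f (edge-∈ʳ x y xy)) w∈h z∈h

  lineGraphLocBijHom : LocBijHom (L G) (L H)
  lineGraphLocBijHom = mkLocBijHom Ψ Ψ-hom Ψ-restrict-injective Ψ-restrict-surjective

module FromLineGraphs {n m} {G : FinGraph n} {H : FinGraph m}
  (G-cubic : Cubic G) (H-cubic : Cubic H) (H-triangleFree : TriangleFree H)
  (F : LocBijHom (L G) (L H)) where
  open LocBijHom F renaming (ψ to Ψ; hom to Ψ-hom)
  open Edges G
  module EH = Edges H
  open EH using () renaming (_∈ᵉ_ to _∈ʰ_)

  Ψ-adj⇒≢ : ∀ e f → T (lineAdj G e f) → Ψ e ≢ Ψ f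
  Ψ-adj⇒≢ e f ef = EH.lineAdj⇒≢ (Ψ e) (Ψ f) (Ψ-hom e f ef)

  module _ (v : Fin n) where
    open ExactlyThree (cubic⇒neighbours G G-cubic v)

    private
      Eᵃ Eᵇ Eᶜ : EdgeOf H
      Eᵃ = Ψ (edge v a Pa)
      Eᵇ = Ψ (edge v b Pb)
      Eᶜ = Ψ (edge v c Pc)

      EᵃEᵇ : T (lineAdj H Eᵃ Eᵇ)
      EᵃEᵇ = Ψ-hom _ _ (edges-at-adjacent Pa Pb a≢b)

      -- Opaque, as unfolding φ v makes every later with-abstraction over it very slow.
      opaque
        Eᵃ∩Eᵇ : ∃[ w ] w ∈ʰ Eᵃ × w ∈ʰ Eᵇ
        Eᵃ∩Eᵇ = proj₂ (EH.lineAdj⇒ Eᵃ Eᵇ EᵃEᵇ)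

    φ : Fin m
    φ = proj₁ Eᵃ∩Eᵇ

    private
      φ∈Eᵃ : φ ∈ʰ Eᵃ
      φ∈Eᵃ = proj₁ (proj₂ Eᵃ∩Eᵇ)

      φ∈Eᵇ : φ ∈ʰ Eᵇ
      φ∈Eᵇ = proj₂ (proj₂ Eᵃ∩Eᵇ)

      φ∈Eᶜ : φ ∈ʰ Eᶜ
      φ∈Eᶜ = triangleFree⇒star H H-triangleFree Eᵃ Eᵇ Eᶜ EᵃEᵇ
        (Ψ-hom _ _ (edges-at-adjacent Pa Pc a≢c)) (Ψ-hom _ _ (edges-at-adjacent Pb Pc b≢c)) φ∈Eᵃ φ∈Eᵇ

    φ-∈Ψ : ∀ e → v ∈ᵉ e → φ ∈ʰ Ψ e
    φ-∈Ψ e v∈e with other-endpoint e v∈e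
    ... | u , u∈e , v≢u with exhaustive u (endpoints-adjacent e v∈e u∈e v≢u)
    ... | inj₁ refl        = subst (λ f → φ ∈ʰ Ψ f) (edge-unique Pa e v∈e u∈e) φ∈Eᵃ
    ... | inj₂ (inj₁ refl) = subst (λ f → φ ∈ʰ Ψ f) (edge-unique Pb e v∈e u∈e) φ∈Eᵇ
    ... | inj₂ (inj₂ refl) = subst (λ f → φ ∈ʰ Ψ f) (edge-unique Pc e v∈e u∈e) φ∈Eᶜ

  -- If φ v = φ u, the images of vu, vx₁, vx₂ and of uy would be four distinct edges of H at φ v.
  φ-adj⇒≢ : ∀ {v u} → T (adjF G v u) → φ v ≢ φ u
  φ-adj⇒≢ {v} {u} vu φv≡φu
    with two-others (cubic⇒neighbours G G-cubic v) vu | two-others (cubic⇒neighbours G G-cubic u) (adj-sym vu)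
  ... | x₁ , x₂ , vx₁ , vx₂ , x₁≢x₂ , x₁≢u , x₂≢u | y , _ , uy , _ , _ , y≢v , _ =
    cubic⇒no-four-edges-at H H-cubic (Ψ e) (Ψ f₁) (Ψ f₂) (Ψ g)
      (φ-∈Ψ v e (edge-∈ˡ v u vu)) (φ-∈Ψ v f₁ (edge-∈ˡ v x₁ vx₁)) (φ-∈Ψ v f₂ (edge-∈ˡ v x₂ vx₂))
      (subst (_∈ʰ Ψ g) (sym φv≡φu) (φ-∈Ψ u g (edge-∈ˡ u y uy)))
      (Ψ-adj⇒≢ e f₁ ef₁) (Ψ-adj⇒≢ e f₂ ef₂) (Ψ-adj⇒≢ e g eg) (Ψ-adj⇒≢ f₁ f₂ (edges-at-adjacent vx₁ vx₂ x₁≢x₂))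
      (f₁≢g ∘ restrict-injective F {e} ef₁ eg) (f₂≢g ∘ restrict-injective F {e} ef₂ eg)
    where
    v≢u : v ≢ u
    v≢u = adj⇒≢ (toGraph G) vu
    e f₁ f₂ g : EdgeOf G
    e  = edge v u vu
    f₁ = edge v x₁ vx₁
    f₂ = edge v x₂ vx₂
    g  = edge u y uy
    ef₁ : T (lineAdj G e f₁)
    ef₁ = edges-at-adjacent vu vx₁ (x₁≢u ∘ sym)
    ef₂ : T (lineAdj G e f₂)
    ef₂ = edges-at-adjacent vu vx₂ (x₂≢u ∘ sym)
    eg : T (lineAdj G e g)
    eg = lineAdj⇐ e g (edge-≢ vu g (edge-∈ʳ u y uy) y≢v (adj⇒≢ (toGraph G) uy ∘ sym))
      (edge-∈ʳ v u vu) (edge-∈ˡ u y uy)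
    f₁≢g : f₁ ≢ g
    f₁≢g = edge-≢ vx₁ g (edge-∈ˡ u y uy) (v≢u ∘ sym) (x₁≢u ∘ sym)
    f₂≢g : f₂ ≢ g
    f₂≢g = edge-≢ vx₂ g (edge-∈ˡ u y uy) (v≢u ∘ sym) (x₂≢u ∘ sym)

  φ-hom : ∀ v u → T (adjF G v u) → T (adjF H (φ v) (φ u))
  φ-hom v u vu =
    EH.endpoints-adjacent (Ψ e) (φ-∈Ψ v e (edge-∈ˡ v u vu)) (φ-∈Ψ u e (edge-∈ʳ v u vu)) (φ-adj⇒≢ vu)
    where
    e : EdgeOf G
    e = edge v u vu

  φ-restrict-injective : ∀ v {x y} → T (adjF G v x) → T (adjF G v y) → φ x ≡ φ y → x ≡ y
  φ-restrict-injective v {x} {y} vx vy φx≡φy with x ≟ y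
  ... | yes x≡y = x≡y
  ... | no x≢y  = ⊥-elim (Ψ-adj⇒≢ eˣ eʸ (edges-at-adjacent vx vy x≢y)
        (EH.edge-determined (Ψ eˣ) (Ψ eʸ) (φ-adj⇒≢ vx)
          (φ-∈Ψ v eˣ (edge-∈ˡ v x vx)) (φ-∈Ψ x eˣ (edge-∈ʳ v x vx))
          (φ-∈Ψ v eʸ (edge-∈ˡ v y vy)) (subst (_∈ʰ Ψ eʸ) (sym φx≡φy) (φ-∈Ψ y eʸ (edge-∈ʳ v y vy)))))
    where
    eˣ eʸ : EdgeOf G
    eˣ = edge v x vx
    eʸ = edge v y vy

  φ-restrict-surjective : ∀ v {w} → T (adjF H (φ v) w) → ∃[ x ] T (adjF G v x) × φ x ≡ w
  φ-restrict-surjective v {w} φv-w = pick (w ≟ φ a) (w ≟ φ b) (w ≟ φ c)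
    where
    open ExactlyThree (cubic⇒neighbours G G-cubic v)
    pick : Dec (w ≡ φ a) → Dec (w ≡ φ b) → Dec (w ≡ φ c) → ∃[ x ] T (adjF G v x) × φ x ≡ w
    pick (yes w≡φa) _          _          = a , Pa , sym w≡φa
    pick (no _)     (yes w≡φb) _          = b , Pb , sym w≡φb
    pick (no _)     (no _)     (yes w≡φc) = c , Pc , sym w≡φc
    pick (no w≢φa)  (no w≢φb)  (no w≢φc)  = ⊥-elim (no-four-distinct (cubic⇒neighbours H H-cubic (φ v))
      φv-w (φ-hom v a Pa) (φ-hom v b Pb) (φ-hom v c Pc) w≢φa w≢φb w≢φc
      (a≢b ∘ φ-restrict-injective v Pa Pb) (a≢c ∘ φ-restrict-injective v Pa Pc) (b≢c ∘ φ-restrict-injective v Pb Pc))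

  graphLocBijHom : LocBijHom (toGraph G) (toGraph H)
  graphLocBijHom = mkLocBijHom φ φ-hom φ-restrict-injective φ-restrict-surjective

theorem2 : ∀ {n m} (G : FinGraph n) (H : FinGraph m) →
    Cubic G → Cubic H → TriangleFree H →
    (LocBijHom (toGraph G) (toGraph H) → LocBijHom (L G) (L H)) ×
    (LocBijHom (L G) (L H) → LocBijHom (toGraph G) (toGraph H))
theorem2 G H G-cubic H-cubic H-triangleFree =
  ToLineGraphs.lineGraphLocBijHom ,
  FromLineGraphs.graphLocBijHom G-cubic H-cubic H-triangleFree
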